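{- Let $N\ge0$, let $\mathcal S\subseteq\Omega_N\cup\{V\}$ with $U_N\in\mathcal S$, and $\mathcal V=\mathcal S\cup\{V\}$. For $n\ge1$, the expected number of steps in a path chosen uniformly at random from $\mathcal P_{\mathcal V}(1,n)$ equals $$n\left(1+\frac{|\mathcal F_{\mathcal V}(0,n)|}{|\mathcal F_{\mathcal V}(1,n)|-|\mathcal F_{\mathcal V}(0,n)|}\right).$$
   Context: Steps: $V=(0,-1)$ and $S_k=(1,k)$ for $k\in\mathbb Z$; $U_k=S_k$ for $k\ge0$. $\Omega_N=\{S_k:k\le N\}$. For a set of steps $\mathcal S$, an $\mathcal S$-path is a finite sequence of steps from $\mathcal S$ starting at $(0,0)$. $\mathcal F_{\mathcal S}(m,n)$ is the set of $\mathcal S$-paths ending at $(n,-m)$; $\mathcal P_{\mathcal S}(m,n)$ is the subset of those all of whose points except possibly the last lie on or above the $x$-axis. -}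

module Defs where

open import Data.Bool using (Bool; true; false; T)
open import Data.Nat as ℕ using (ℕ; zero; suc)
open import Data.Integer as ℤ using (ℤ; +_; -_)
open import Data.Rational as ℚ using (ℚ; 0ℚ; _÷_; ≢-nonZero)
open import Data.Rational.Properties as ℚP using ()
open import Data.Fin using (Fin)
open import Data.List using (List; []; _∷_; length; map; allFin)
open import Data.Nat.ListAction using (sum)
open import Data.List.Relation.Unary.All using (All)
open import Data.Product using (Σ; _×_; proj₁)
open import Data.Unit using (⊤)
open import Function.Bundles using (_↔_; Inverse)
open import Relation.Binary.PropositionalEquality using (_≡_)
open import Relation.Nullary using (yes; no)

data Step : Set where
  V : Step
  S : ℤ → Step

dx : Step → ℕ
dx V     = 0
dx (S k) = 1

dy : Step → ℤ
dy V     = - (+ 1)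
dy (S k) = k

-- A set of steps 𝒮 ⊆ Ω_N ∪ {V} is encoded by σ : ℤ → Bool (which S_k lie in 𝒮);
-- 𝒱 = 𝒮 ∪ {V} always contains V.
inV : (ℤ → Bool) → Step → Bool
inV σ V     = true
inV σ (S k) = σ k

endX : List Step → ℕ
endX []      = 0
endX (s ∷ p) = dx s ℕ.+ endX p

endY : List Step → ℤ
endY []      = + 0
endY (s ∷ p) = dy s ℤ.+ endY p

AboveExceptLast : ℤ → List Step → Set
AboveExceptLast h []      = ⊤
AboveExceptLast h (s ∷ p) = (+ 0 ℤ.≤ h) × AboveExceptLast (h ℤ.+ dy s) p

InF : (ℤ → Bool) → ℕ → ℕ → List Step → Set
InF σ m n p = All (λ s → T (inV σ s)) p × (endX p ≡ n) × (endY p ≡ - (+ m))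

InP : (ℤ → Bool) → ℕ → ℕ → List Step → Set
InP σ m n p = InF σ m n p × AboveExceptLast (+ 0) p

F : (ℤ → Bool) → ℕ → ℕ → Set
F σ m n = Σ (List Step) (InF σ m n)

P : (ℤ → Bool) → ℕ → ℕ → Set
P σ m n = Σ (List Step) (InP σ m n)

Enum : Set → ℕ → Set
Enum A c = Fin c ↔ A

-- total division on ℚ (x / 0 := 0); only used where the denominator is shown nonzero
_/ℚ_ : ℚ → ℚ → ℚ
p /ℚ q with q ℚP.≟ 0ℚ
... | yes _  = 0ℚ
... | no q≢0 = _÷_ p q {{≢-nonZero q≢0}}

ℕ→ℚ : ℕ → ℚ
ℕ→ℚ n = ℚ._/_ (+ n) 1

totalSteps : ∀ {Q : List Step → Set} {c} → Enum (Σ (List Step) Q) c → ℕ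
totalSteps {c = c} e = sum (map (λ i → length (proj₁ (Inverse.to e i))) (allFin c))

expectedSteps : ∀ {Q : List Step → Set} {c} → Enum (Σ (List Step) Q) c → ℚ
expectedSteps {c = c} e = ℕ→ℚ (totalSteps e) /ℚ ℕ→ℚ c

-- Cycle lemma: a path ending one unit below its start has exactly one cyclic
-- rotation that stays weakly above its starting height until the final step,
-- namely the rotation starting at its first lowest point. Hence the 𝓕(1,n)-paths
-- correspond to the 𝓟(1,n)-paths q with a marked step (the new first step), so
-- |𝓕(1,n)| = Σ_q |q|; marking only V-steps and deleting the leading V gives
-- |𝓕(0,n)| = Σ_q #V(q). As |q| = n + #V(q), the total length is
-- |𝓕(1,n)| = n |𝓟(1,n)| + |𝓕(0,n)|, and dividing by |𝓟(1,n)| gives the formula.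
module Submission where

open import Defs
open import Data.Bool using (Bool; true; false; T; if_then_else_)
open import Data.Bool.Properties using (T-irrelevant)
open import Data.Empty using (⊥; ⊥-elim)
open import Data.Fin using (Fin; zero; suc)
import Data.Fin.Properties as FinP
open import Data.Integer as ℤ using (ℤ; +_; -1ℤ)
import Data.Integer.Properties as ℤP
open import Data.Integer.Tactic.RingSolver using (solve-∀)
open import Data.List using (List; []; _∷_; _++_; length; tabulate; replicate)
import Data.List.Properties as ListP
open import Data.List.Relation.Unary.All as All using (All; []; _∷_)
import Data.List.Relation.Unary.All.Properties as AllP
open import Data.Nat as ℕ using (ℕ; zero; suc; _≤_; _<_; NonZero)
open import Data.Nat.ListAction using (sum)
import Data.Nat.Properties as ℕP
import Data.Nat.Tactic.RingSolver as ℕSolver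
open import Data.Product using (Σ; ∃₂; _×_; _,_; proj₁; proj₂)
open import Data.Product.Function.Dependent.Propositional using (Σ-↔)
open import Data.Rational as ℚ using (0ℚ; 1ℚ; mkℚ; 1/_; ↥_; ≢-nonZero)
import Data.Rational.Properties as ℚP
open import Data.Rational.Solver using (module +-*-Solver)
open import Data.Sum using (_⊎_; inj₁; inj₂)
open import Data.Sum.Function.Propositional using (_⊎-↔_)
open import Data.Unit using (tt)
open import Function using (_∘_; const)
open import Function.Bundles using (_↔_; Inverse; Injection; mk↔ₛ′)
open import Function.Properties.Inverse using (↔-refl; ↔-sym; ↔-trans; ↔⇒↣)
open import Relation.Binary.PropositionalEquality
open import Relation.Nullary using (yes; no)
open import Axiom.UniquenessOfIdentityProofs using (module Decidable⇒UIP)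
import Data.Nat.Coprimality as Coprimality

++-≡-++⁻ : ∀ {A : Set} (s t s' t' : List A) → s ++ t ≡ s' ++ t' →
           (Σ (List A) λ m → s' ≡ s ++ m × t ≡ m ++ t') ⊎
           (Σ (List A) λ m → s ≡ s' ++ m × t' ≡ m ++ t)
++-≡-++⁻ []      t s'       t' eq = inj₁ (s' , refl , eq)
++-≡-++⁻ (x ∷ s) t []       t' eq = inj₂ (x ∷ s , refl , sym eq)
++-≡-++⁻ (x ∷ s) t (y ∷ s') t' eq with ListP.∷-injective eq
... | refl , eq′ with ++-≡-++⁻ s t s' t' eq′
...   | inj₁ (m , refl , t≡) = inj₁ (m , refl , t≡)
...   | inj₂ (m , refl , t'≡) = inj₂ (m , refl , t'≡)

record Position {A : Set} (Q : A → Bool) (q : List A) : Set where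
  constructor position
  field
    before  : List A
    at      : A
    after   : List A
    rebuild : before ++ at ∷ after ≡ q
    holds   : T (Q at)

count : ∀ {A : Set} → (A → Bool) → List A → ℕ
count Q []      = 0
count Q (x ∷ q) = (if Q x then 1 else 0) ℕ.+ count Q q

T-↔-Fin : ∀ b → T b ↔ Fin (if b then 1 else 0)
T-↔-Fin true  = mk↔ₛ′ (λ _ → zero) (λ _ → tt) (λ { zero → refl }) (λ _ → refl)
T-↔-Fin false = mk↔ₛ′ (λ ()) (λ ()) (λ ()) (λ ())

module _ {A : Set} (Q : A → Bool) where

  Position-[] : Position Q [] ↔ Fin 0
  Position-[] = mk↔ₛ′ (λ { (position [] _ _ () _) ; (position (_ ∷ _) _ _ () _) })
                      (λ ()) (λ ()) (λ { (position [] _ _ () _) ; (position (_ ∷ _) _ _ () _) })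

  Position-∷ : ∀ x q → Position Q (x ∷ q) ↔ (T (Q x) ⊎ Position Q q)
  Position-∷ x q = mk↔ₛ′ to from to∘from from∘to
    where
    to : Position Q (x ∷ q) → T (Q x) ⊎ Position Q q
    to (position []      _ _ refl h) = inj₁ h
    to (position (_ ∷ a) y b refl h) = inj₂ (position a y b refl h)
    from : T (Q x) ⊎ Position Q q → Position Q (x ∷ q)
    from (inj₁ h)                    = position [] x q refl h
    from (inj₂ (position a y b e h)) = position (x ∷ a) y b (cong (x ∷_) e) h
    to∘from : ∀ z → to (from z) ≡ z
    to∘from (inj₁ h)                       = refl
    to∘from (inj₂ (position a y b refl h)) = refl
    from∘to : ∀ p → from (to p) ≡ p
    from∘to (position []      _ _ refl h) = refl
    from∘to (position (_ ∷ a) y b refl h) = refl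

  Position-↔-count : ∀ q → Position Q q ↔ Fin (count Q q)
  Position-↔-count []      = Position-[]
  Position-↔-count (x ∷ q) =
    ↔-trans (Position-∷ x q) (↔-trans (T-↔-Fin (Q x) ⊎-↔ Position-↔-count q) (↔-sym FinP.+↔⊎))

count-true : ∀ {A : Set} (q : List A) → count (const true) q ≡ length q
count-true []      = refl
count-true (_ ∷ q) = cong suc (count-true q)

Fin-↔⇒≡ : ∀ {m k} → Fin m ↔ Fin k → m ≡ k
Fin-↔⇒≡ e = ℕP.≤-antisym (FinP.injective⇒≤ (Injection.injective (↔⇒↣ e)))
                         (FinP.injective⇒≤ (Injection.injective (↔⇒↣ (↔-sym e))))

Σ-Fin-↔-sum : ∀ c (h : Fin c → ℕ) → Σ (Fin c) (Fin ∘ h) ↔ Fin (sum (tabulate h))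
Σ-Fin-↔-sum zero    h = mk↔ₛ′ (λ { (() , _) }) (λ ()) (λ ()) (λ { (() , _) })
Σ-Fin-↔-sum (suc c) h =
  ↔-trans split (↔-trans (↔-refl ⊎-↔ Σ-Fin-↔-sum c (h ∘ suc)) (↔-sym FinP.+↔⊎))
  where
  split : Σ (Fin (suc c)) (Fin ∘ h) ↔ (Fin (h zero) ⊎ Σ (Fin c) (Fin ∘ h ∘ suc))
  split = mk↔ₛ′ (λ { (zero , j) → inj₁ j ; (suc i , j) → inj₂ (i , j) })
                (λ { (inj₁ j) → zero , j ; (inj₂ (i , j)) → suc i , j })
                (λ { (inj₁ _) → refl ; (inj₂ _) → refl })
                (λ { (zero , _) → refl ; (suc _ , _) → refl })

Σ-↔-sum : ∀ {c} {A : Set} {B : A → Set} (e : Fin c ↔ A) (h : A → ℕ) →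
          (∀ a → B a ↔ Fin (h a)) → Σ A B ↔ Fin (sum (tabulate (h ∘ Inverse.to e)))
Σ-↔-sum {c} e h B↔ =
  ↔-trans (↔-sym (Σ-↔ e ↔-refl)) (↔-trans (Σ-↔ ↔-refl (B↔ _)) (Σ-Fin-↔-sum c (h ∘ Inverse.to e)))

sum-tabulate-+ : ∀ c n (g : Fin c → ℕ) →
                 sum (tabulate (λ i → n ℕ.+ g i)) ≡ c ℕ.* n ℕ.+ sum (tabulate g)
sum-tabulate-+ zero    n g = refl
sum-tabulate-+ (suc c) n g rewrite sum-tabulate-+ c n (g ∘ suc) =
  interchange n (g zero) (c ℕ.* n) (sum (tabulate (g ∘ suc)))
  where
  interchange : ∀ a b d e → a ℕ.+ b ℕ.+ (d ℕ.+ e) ≡ a ℕ.+ d ℕ.+ (b ℕ.+ e)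
  interchange = ℕSolver.solve-∀

endX-++ : ∀ a b → endX (a ++ b) ≡ endX a ℕ.+ endX b
endX-++ []      b = refl
endX-++ (s ∷ a) b = trans (cong (dx s ℕ.+_) (endX-++ a b)) (sym (ℕP.+-assoc (dx s) (endX a) (endX b)))

endY-++ : ∀ a b → endY (a ++ b) ≡ endY a ℤ.+ endY b
endY-++ []      b = sym (ℤP.+-identityˡ (endY b))
endY-++ (s ∷ a) b = trans (cong (ℤ._+_ (dy s)) (endY-++ a b)) (sym (ℤP.+-assoc (dy s) (endY a) (endY b)))

endX-rotate : ∀ a b → endX (a ++ b) ≡ endX (b ++ a)
endX-rotate a b = trans (endX-++ a b) (trans (ℕP.+-comm (endX a) (endX b)) (sym (endX-++ b a)))

endY-rotate : ∀ a b → endY (a ++ b) ≡ endY (b ++ a)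
endY-rotate a b = trans (endY-++ a b) (trans (ℤP.+-comm (endY a) (endY b)) (sym (endY-++ b a)))

AboveExceptLast-irrelevant : ∀ h p (x y : AboveExceptLast h p) → x ≡ y
AboveExceptLast-irrelevant h []      tt      tt        = refl
AboveExceptLast-irrelevant h (s ∷ p) (x , y) (x' , y') =
  cong₂ _,_ (ℤP.≤-irrelevant x x') (AboveExceptLast-irrelevant _ p y y')

AboveExceptLast-mono : ∀ {h h'} p → h ℤ.≤ h' → AboveExceptLast h p → AboveExceptLast h' p
AboveExceptLast-mono []      _    _       = tt
AboveExceptLast-mono (s ∷ p) h≤h' (0≤h , rest) =
  ℤP.≤-trans 0≤h h≤h' , AboveExceptLast-mono p (ℤP.+-monoˡ-≤ (dy s) h≤h') rest

AboveExceptLast-++⁺ : ∀ {h} a b → AboveExceptLast h a → AboveExceptLast (h ℤ.+ endY a) b →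
                      AboveExceptLast h (a ++ b)
AboveExceptLast-++⁺ {h} []      b _ above = subst (λ k → AboveExceptLast k b) (ℤP.+-identityʳ h) above
AboveExceptLast-++⁺ {h} (s ∷ a) b (0≤h , aboveA) aboveB =
  0≤h , AboveExceptLast-++⁺ a b aboveA
          (subst (λ k → AboveExceptLast k b) (sym (ℤP.+-assoc h (dy s) (endY a))) aboveB)

AboveExceptLast-++⇒0≤ : ∀ {h} a b → b ≢ [] → AboveExceptLast h (a ++ b) → + 0 ℤ.≤ h ℤ.+ endY a
AboveExceptLast-++⇒0≤ {h} []      []      b≢[] _          = ⊥-elim (b≢[] refl)
AboveExceptLast-++⇒0≤ {h} []      (_ ∷ _) _    (0≤h , _)  = subst (+ 0 ℤ.≤_) (sym (ℤP.+-identityʳ h)) 0≤h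
AboveExceptLast-++⇒0≤ {h} (s ∷ a) b       b≢[] (_ , rest) =
  subst (+ 0 ℤ.≤_) (ℤP.+-assoc h (dy s) (endY a)) (AboveExceptLast-++⇒0≤ a b b≢[] rest)

-- The cycle lemma

-- w = before ++ after, cut at the first point of minimal height among all
-- points of w but its endpoint: every earlier point lies strictly higher.
record LowestPointSplit (w : List Step) : Set where
  constructor split
  field
    before      : List Step
    after       : List Step
    splits      : w ≡ before ++ after
    beforeAbove : AboveExceptLast (-1ℤ ℤ.- endY before) before
    afterAbove  : AboveExceptLast (+ 0) after

-- Prepending x, the new starting point becomes the first lowest point unless the
-- old one, at relative height dy x + endY u, lies strictly below it.
lowestPointSplit : ∀ w → LowestPointSplit w
lowestPointSplit []      = split [] [] refl tt tt
lowestPointSplit (x ∷ w) with lowestPointSplit w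
... | split u v refl aboveU aboveV with + 0 ℤ.≤? dy x ℤ.+ endY u
...   | yes 0≤ =
  split [] (x ∷ u ++ v) refl tt
    (ℤP.≤-refl , AboveExceptLast-++⁺ u v (AboveExceptLast-mono u (lower-start 0≤) aboveU)
                                       (AboveExceptLast-mono v (raise-end 0≤) aboveV))
  where
  lower-start : + 0 ℤ.≤ dy x ℤ.+ endY u → -1ℤ ℤ.- endY u ℤ.≤ + 0 ℤ.+ dy x
  lower-start 0≤ = subst₂ ℤ._≤_ refl (cancel (dy x) (endY u))
                     (ℤP.+-monoˡ-≤ (ℤ.- endY u) (ℤP.≤-trans ℤ.-≤+ 0≤))
    where
    cancel : ∀ d e → d ℤ.+ e ℤ.- e ≡ + 0 ℤ.+ d
    cancel = solve-∀
  raise-end : + 0 ℤ.≤ dy x ℤ.+ endY u → + 0 ℤ.≤ (+ 0 ℤ.+ dy x) ℤ.+ endY u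
  raise-end = subst (λ k → + 0 ℤ.≤ k ℤ.+ endY u) (sym (ℤP.+-identityˡ (dy x)))
...   | no ≰ =
  split (x ∷ u) v refl
    (ℤP.i≤j⇒0≤j-i (ℤP.i<j⇒i≤pred[j] (ℤP.≰⇒> ≰)) ,
     subst (λ k → AboveExceptLast k u) (sym (shift (dy x) (endY u))) aboveU)
    aboveV
  where
  shift : ∀ d e → -1ℤ ℤ.- (d ℤ.+ e) ℤ.+ d ≡ -1ℤ ℤ.- e
  shift = solve-∀

rotate-at-lowest : ∀ u v → endY (u ++ v) ≡ -1ℤ →
                   AboveExceptLast (-1ℤ ℤ.- endY u) u → AboveExceptLast (+ 0) v →
                   AboveExceptLast (+ 0) (v ++ u)
rotate-at-lowest u v total aboveU aboveV =
  AboveExceptLast-++⁺ v u aboveV (subst (λ k → AboveExceptLast k u) start aboveU)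
  where
  difference : ∀ a b → a ℤ.+ b ℤ.- a ≡ + 0 ℤ.+ b
  difference = solve-∀
  start : -1ℤ ℤ.- endY u ≡ + 0 ℤ.+ endY v
  start = trans (cong (ℤ._- endY u) (trans (sym total) (endY-++ u v))) (difference (endY u) (endY v))

cycle-lemma : ∀ x r → endY (x ∷ r) ≡ -1ℤ →
              ∃₂ λ a b → r ≡ b ++ a × AboveExceptLast (+ 0) (a ++ x ∷ b)
cycle-lemma x r total with lowestPointSplit (x ∷ r)
... | split []      _ refl _      aboveV = [] , r , sym (ListP.++-identityʳ r) , aboveV
... | split (y ∷ b) a eq   aboveU aboveV with ListP.∷-injective eq
...   | refl , refl = a , b , refl , rotate-at-lowest (x ∷ b) a total aboveU aboveV

-- In the two rotations m ++ t ++ s and t ++ s ++ m, the proper prefixes m and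
-- t ++ s would both end at height ≥ 0, yet their heights add up to -1.
no-two-good-cuts : ∀ s m t → s ≢ [] → m ≢ [] → endY (s ++ m ++ t) ≡ -1ℤ →
                   AboveExceptLast (+ 0) ((m ++ t) ++ s) → AboveExceptLast (+ 0) (t ++ s ++ m) → ⊥
no-two-good-cuts s m t s≢[] m≢[] total above₁ above₂ = contradiction
  where
  0≤m : + 0 ℤ.≤ endY m
  0≤m = subst (+ 0 ℤ.≤_) (ℤP.+-identityˡ (endY m))
          (AboveExceptLast-++⇒0≤ m (t ++ s) (s≢[] ∘ ListP.++-conicalʳ t s)
            (subst (AboveExceptLast (+ 0)) (ListP.++-assoc m t s) above₁))
  0≤ts : + 0 ℤ.≤ endY (t ++ s)
  0≤ts = subst (+ 0 ℤ.≤_) (ℤP.+-identityˡ (endY (t ++ s)))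
           (AboveExceptLast-++⇒0≤ (t ++ s) m m≢[]
             (subst (AboveExceptLast (+ 0)) (sym (ListP.++-assoc t s m)) above₂))
  sum≡-1 : endY m ℤ.+ endY (t ++ s) ≡ -1ℤ
  sum≡-1 = begin
    endY m ℤ.+ endY (t ++ s) ≡⟨ endY-++ m (t ++ s) ⟨
    endY (m ++ t ++ s)       ≡⟨ cong endY (ListP.++-assoc m t s) ⟨
    endY ((m ++ t) ++ s)     ≡⟨ endY-rotate s (m ++ t) ⟨
    endY (s ++ m ++ t)       ≡⟨ total ⟩
    -1ℤ                      ∎
    where open ≡-Reasoning
  contradiction : ⊥
  contradiction with subst (+ 0 ℤ.≤_) sum≡-1 (ℤP.+-mono-≤ 0≤m 0≤ts)
  ... | ()

good-cut-unique : ∀ s t s' t' → s ≢ [] → s' ≢ [] → s ++ t ≡ s' ++ t' → endY (s ++ t) ≡ -1ℤ →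
                  AboveExceptLast (+ 0) (t ++ s) → AboveExceptLast (+ 0) (t' ++ s') → s ≡ s'
good-cut-unique s t s' t' s≢[] s'≢[] eq total above above' with ++-≡-++⁻ s t s' t' eq
... | inj₁ ([]        , refl , _)    = sym (ListP.++-identityʳ s)
... | inj₁ (m@(_ ∷ _) , refl , refl) = ⊥-elim (no-two-good-cuts s m t' s≢[] (λ ()) total above above')
... | inj₂ ([]        , refl , _)    = ListP.++-identityʳ s'
... | inj₂ (m@(_ ∷ _) , refl , refl) =
  ⊥-elim (no-two-good-cuts s' m t s'≢[] (λ ()) (trans (cong endY (sym (ListP.++-assoc s' m t))) total) above' above)

cycle-lemma-unique : ∀ x a b a' b' → b ++ a ≡ b' ++ a' → endY (x ∷ b ++ a) ≡ -1ℤ →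
                     AboveExceptLast (+ 0) (a ++ x ∷ b) → AboveExceptLast (+ 0) (a' ++ x ∷ b') →
                     a ≡ a' × b ≡ b'
cycle-lemma-unique x a b a' b' eq total above above'
  with good-cut-unique (x ∷ b) a (x ∷ b') a' (λ ()) (λ ()) (cong (x ∷_) eq) total above above'
... | refl = ListP.++-cancelˡ b a a' eq , refl

-- Counting paths by their cut points

FirstStep : (Step → Bool) → List Step → Set
FirstStep Q []      = ⊥
FirstStep Q (x ∷ _) = T (Q x)

isVertical : Step → Bool
isVertical V     = true
isVertical (S _) = false

length≡endX+count-isVertical : ∀ q → length q ≡ endX q ℕ.+ count isVertical q
length≡endX+count-isVertical []      = refl
length≡endX+count-isVertical (V ∷ q) =
  trans (cong suc (length≡endX+count-isVertical q)) (sym (ℕP.+-suc (endX q) _))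
length≡endX+count-isVertical (S _ ∷ q) = cong suc (length≡endX+count-isVertical q)

totalSteps≡Σlength : ∀ {Q : List Step → Set} {c} (e : Enum (Σ (List Step) Q) c) →
                     totalSteps e ≡ sum (tabulate (length ∘ proj₁ ∘ Inverse.to e))
totalSteps≡Σlength e = cong sum (ListP.map-tabulate (λ i → i) (length ∘ proj₁ ∘ Inverse.to e))

module _ (σ : ℤ → Bool) (n : ℕ) where

  InF-irrelevant : ∀ {m} p (x y : InF σ m n p) → x ≡ y
  InF-irrelevant p (a , b , c) (a' , b' , c') =
    cong₂ _,_ (All.irrelevant T-irrelevant a a')
              (cong₂ _,_ (ℕP.≡-irrelevant b b') (Decidable⇒UIP.≡-irrelevant ℤ._≟_ c c'))

  InP-irrelevant : ∀ {m} p (x y : InP σ m n p) → x ≡ y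
  InP-irrelevant p (a , b) (a' , b') = cong₂ _,_ (InF-irrelevant p a a') (AboveExceptLast-irrelevant _ p b b')

  InF-rotate : ∀ {m} a b → InF σ m n (a ++ b) → InF σ m n (b ++ a)
  InF-rotate a b (steps , ex , ey) =
    AllP.++⁺ (AllP.++⁻ʳ a steps) (AllP.++⁻ˡ a steps) ,
    trans (endX-rotate b a) ex ,
    trans (endY-rotate b a) ey

  module _ (Q : Step → Bool) where

    -- A 𝓟-path with a marked Q-step x, written a ++ x ∷ b, corresponds to
    -- the 𝓕-path x ∷ b ++ a, whose first step is x.
    cut-↔ : Σ (P σ 1 n) (Position Q ∘ proj₁) ↔ Σ (F σ 1 n) (FirstStep Q ∘ proj₁)
    cut-↔ = mk↔ₛ′ rotate unrotate rotate∘unrotate unrotate∘rotate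
      where
      rotate : Σ (P σ 1 n) (Position Q ∘ proj₁) → Σ (F σ 1 n) (FirstStep Q ∘ proj₁)
      rotate ((_ , inF , _) , position a x b refl qx) = (x ∷ b ++ a , InF-rotate a (x ∷ b) inF) , qx

      unrotate : Σ (F σ 1 n) (FirstStep Q ∘ proj₁) → Σ (P σ 1 n) (Position Q ∘ proj₁)
      unrotate ((x ∷ r , inF) , qx) with cycle-lemma x r (proj₂ (proj₂ inF))
      ... | a , b , r≡ , above =
        (a ++ x ∷ b , InF-rotate (x ∷ b) a (subst (λ r′ → InF σ 1 n (x ∷ r′)) r≡ inF) , above) ,
        position a x b refl qx

      rotate∘unrotate : ∀ w → rotate (unrotate w) ≡ w
      rotate∘unrotate ((x ∷ r , inF) , qx) with cycle-lemma x r (proj₂ (proj₂ inF))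
      ... | a , b , refl , above =
        cong (λ inF′ → (x ∷ b ++ a , inF′) , qx) (InF-irrelevant (x ∷ b ++ a) _ _)

      same-cut : ∀ {x a b a' b'} → a ≡ a' → b ≡ b' →
                 (inP : InP σ 1 n (a ++ x ∷ b)) (inP' : InP σ 1 n (a' ++ x ∷ b')) (qx qx' : T (Q x)) →
                 _≡_ {A = Σ (P σ 1 n) (Position Q ∘ proj₁)}
                   ((_ , inP) , position a x b refl qx) ((_ , inP') , position a' x b' refl qx')
      same-cut refl refl inP inP' qx qx' =
        cong₂ (λ i h → (_ , i) , position _ _ _ refl h) (InP-irrelevant _ inP inP') (T-irrelevant qx qx')

      unrotate∘rotate : ∀ c → unrotate (rotate c) ≡ c
      unrotate∘rotate ((_ , inF , above) , position a x b refl qx)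
        with cycle-lemma x (b ++ a) (proj₂ (proj₂ (InF-rotate a (x ∷ b) inF)))
      ... | a' , b' , eq , above'
        with cycle-lemma-unique x a b a' b' eq (proj₂ (proj₂ (InF-rotate a (x ∷ b) inF))) above above'
      ...   | a≡a' , b≡b' = same-cut (sym a≡a') (sym b≡b') _ _ qx qx

    count-cuts : ∀ {cp} (e : Enum (P σ 1 n) cp) →
                 Σ (F σ 1 n) (FirstStep Q ∘ proj₁) ↔ Fin (sum (tabulate (count Q ∘ proj₁ ∘ Inverse.to e)))
    count-cuts e = ↔-trans (↔-sym cut-↔) (Σ-↔-sum e (count Q ∘ proj₁) (Position-↔-count Q ∘ proj₁))

  F-↔-FirstStep-true : F σ 1 n ↔ Σ (F σ 1 n) (FirstStep (const true) ∘ proj₁)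
  F-↔-FirstStep-true = mk↔ₛ′ nonempty proj₁ (λ { ((_ ∷ _ , _) , _) → refl }) (λ { (_ ∷ _ , _) → refl })
    where
    nonempty : F σ 1 n → Σ (F σ 1 n) (FirstStep (const true) ∘ proj₁)
    nonempty ([]    , _ , _ , ())
    nonempty (x ∷ r , inF)   = (x ∷ r , inF) , tt

  F₀-↔-FirstStep-V : F σ 0 n ↔ Σ (F σ 1 n) (FirstStep isVertical ∘ proj₁)
  F₀-↔-FirstStep-V = mk↔ₛ′ prepend-V drop-V prepend∘drop drop∘prepend
    where
    cancel : ∀ e → -1ℤ ℤ.+ e ≡ -1ℤ → e ≡ + 0
    cancel e eq = trans (sym (undo e)) (cong (ℤ._+_ (+ 1)) eq)
      where
      undo : ∀ e → + 1 ℤ.+ (-1ℤ ℤ.+ e) ≡ e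
      undo = solve-∀
    prepend-V : F σ 0 n → Σ (F σ 1 n) (FirstStep isVertical ∘ proj₁)
    prepend-V (r , steps , ex , ey) = (V ∷ r , tt ∷ steps , ex , cong (ℤ._+_ -1ℤ) ey) , tt
    drop-V : Σ (F σ 1 n) (FirstStep isVertical ∘ proj₁) → F σ 0 n
    drop-V ((V ∷ r , _ ∷ steps , ex , ey) , _) = r , steps , ex , cancel (endY r) ey
    prepend∘drop : ∀ w → prepend-V (drop-V w) ≡ w
    prepend∘drop ((V ∷ r , inF@(_ ∷ _ , _)) , _) =
      cong (λ inF′ → (V ∷ r , inF′) , tt) (InF-irrelevant (V ∷ r) _ _)
    drop∘prepend : ∀ w → drop-V (prepend-V w) ≡ w
    drop∘prepend (r , inF) = cong (r ,_) (InF-irrelevant {0} r _ _)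

  F⇒P : F σ 1 n → P σ 1 n
  F⇒P = proj₁ ∘ Inverse.from (cut-↔ (const true)) ∘ Inverse.to F-↔-FirstStep-true

  length-P : (q : P σ 1 n) → length (proj₁ q) ≡ n ℕ.+ count isVertical (proj₁ q)
  length-P (q , (_ , ex , _) , _) = trans (length≡endX+count-isVertical q) (cong (ℕ._+ count isVertical q) ex)

  module _ {cp} (e : Enum (P σ 1 n) cp) where

    private
      path : Fin cp → List Step
      path = proj₁ ∘ Inverse.to e

    card-F₁≡Σlength : ∀ {c1} → Enum (F σ 1 n) c1 → c1 ≡ sum (tabulate (length ∘ path))
    card-F₁≡Σlength E1 =
      trans (Fin-↔⇒≡ (↔-trans E1 (↔-trans F-↔-FirstStep-true (count-cuts (const true) e))))
            (cong sum (ListP.tabulate-cong (count-true ∘ path)))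

    card-F₀≡Σ#V : ∀ {c0} → Enum (F σ 0 n) c0 → c0 ≡ sum (tabulate (count isVertical ∘ path))
    card-F₀≡Σ#V E0 = Fin-↔⇒≡ (↔-trans E0 (↔-trans F₀-↔-FirstStep-V (count-cuts isVertical e)))

    Σlength≡cp*n+Σ#V : sum (tabulate (length ∘ path)) ≡ cp ℕ.* n ℕ.+ sum (tabulate (count isVertical ∘ path))
    Σlength≡cp*n+Σ#V =
      trans (cong sum (ListP.tabulate-cong (length-P ∘ Inverse.to e))) (sum-tabulate-+ cp n _)

zigzags : ℕ → ℕ → List Step
zigzags N zero    = []
zigzags N (suc k) = S (+ N) ∷ replicate N V ++ zigzags N k

endX-replicate-V : ∀ k → endX (replicate k V) ≡ 0
endX-replicate-V zero    = refl
endX-replicate-V (suc k) = endX-replicate-V k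

endY-replicate-V : ∀ k → endY (replicate k V) ≡ ℤ.- (+ k)
endY-replicate-V zero    = refl
endY-replicate-V (suc k) = trans (cong (ℤ._+_ -1ℤ) (endY-replicate-V k)) (sym (ℤP.neg-suc k))

endX-zigzags : ∀ N k → endX (zigzags N k) ≡ k
endX-zigzags N zero    = refl
endX-zigzags N (suc k) =
  cong suc (trans (endX-++ (replicate N V) (zigzags N k)) (cong₂ ℕ._+_ (endX-replicate-V N) (endX-zigzags N k)))

endY-zigzags : ∀ N k → endY (zigzags N k) ≡ + 0
endY-zigzags N zero    = refl
endY-zigzags N (suc k) =
  trans (cong (ℤ._+_ (+ N)) (trans (endY-++ (replicate N V) (zigzags N k))
                                   (cong₂ ℤ._+_ (endY-replicate-V N) (endY-zigzags N k))))
        (cancel (+ N))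
  where
  cancel : ∀ a → a ℤ.+ (ℤ.- a ℤ.+ + 0) ≡ + 0
  cancel = solve-∀

zigzags-steps : ∀ σ N → T (σ (+ N)) → ∀ k → All (T ∘ inV σ) (zigzags N k)
zigzags-steps σ N S-N∈𝒮 zero    = []
zigzags-steps σ N S-N∈𝒮 (suc k) = S-N∈𝒮 ∷ AllP.++⁺ (AllP.replicate⁺ N tt) (zigzags-steps σ N S-N∈𝒮 k)

V∷zigzags∈F : ∀ σ N → T (σ (+ N)) → ∀ n → F σ 1 n
V∷zigzags∈F σ N S-N∈𝒮 n =
  V ∷ zigzags N n , tt ∷ zigzags-steps σ N S-N∈𝒮 n , endX-zigzags N n , cong (ℤ._+_ -1ℤ) (endY-zigzags N n)

ℕ→ℚ≡mkℚ : ∀ k → ℕ→ℚ k ≡ mkℚ (+ k) 0 (Coprimality.sym (Coprimality.1-coprimeTo k))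
ℕ→ℚ≡mkℚ k = ℚP.normalize-coprime (Coprimality.sym (Coprimality.1-coprimeTo k))

ℕ→ℚ-+ : ∀ a b → ℕ→ℚ (a ℕ.+ b) ≡ ℕ→ℚ a ℚ.+ ℕ→ℚ b
ℕ→ℚ-+ a b rewrite ℕ→ℚ≡mkℚ a | ℕ→ℚ≡mkℚ b =
  cong (λ z → z ℚ./ 1) (sym (cong₂ ℤ._+_ (ℤP.*-identityʳ (+ a)) (ℤP.*-identityʳ (+ b))))

ℕ→ℚ-* : ∀ a b → ℕ→ℚ (a ℕ.* b) ≡ ℕ→ℚ a ℚ.* ℕ→ℚ b
ℕ→ℚ-* a b rewrite ℕ→ℚ≡mkℚ a | ℕ→ℚ≡mkℚ b = cong (λ z → z ℚ./ 1) (ℤP.pos-* a b)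

ℕ→ℚ-≢0 : ∀ k .{{_ : NonZero k}} → ℕ→ℚ k ≢ 0ℚ
ℕ→ℚ-≢0 (suc k) eq with cong ↥_ (trans (sym (ℕ→ℚ≡mkℚ (suc k))) (trans eq (ℕ→ℚ≡mkℚ 0)))
... | ()

/ℚ-*-cancel : ∀ x q → q ≢ 0ℚ → (x /ℚ q) ℚ.* q ≡ x
/ℚ-*-cancel x q q≢0 with q ℚP.≟ 0ℚ
... | yes q≡0 = ⊥-elim (q≢0 q≡0)
... | no  _   = begin
  x ℚ.* 1/q ℚ.* q   ≡⟨ ℚP.*-assoc x 1/q q ⟩
  x ℚ.* (1/q ℚ.* q) ≡⟨ cong (x ℚ.*_) (ℚP.*-inverseˡ q {{≢-nonZero q≢0}}) ⟩
  x ℚ.* 1ℚ          ≡⟨ ℚP.*-identityʳ x ⟩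
  x                 ∎
  where
  open ≡-Reasoning
  1/q = (1/ q) {{≢-nonZero q≢0}}

/ℚ-unique : ∀ x q y → q ≢ 0ℚ → y ℚ.* q ≡ x → x /ℚ q ≡ y
/ℚ-unique x q y q≢0 refl with q ℚP.≟ 0ℚ
... | yes q≡0 = ⊥-elim (q≢0 q≡0)
... | no  _   = begin
  y ℚ.* q ℚ.* 1/q   ≡⟨ ℚP.*-assoc y q 1/q ⟩
  y ℚ.* (q ℚ.* 1/q) ≡⟨ cong (y ℚ.*_) (ℚP.*-inverseʳ q {{≢-nonZero q≢0}}) ⟩
  y ℚ.* 1ℚ          ≡⟨ ℚP.*-identityʳ y ⟩
  y                 ∎
  where
  open ≡-Reasoning
  1/q = (1/ q) {{≢-nonZero q≢0}}

-- With d = c₀ / (c₁ - c₀) and c₁ - c₀ = p n, the claim n (1 + d) p = c₁ is the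
-- ring identity n (1 + d) p = p n + d (p n).
expectation-formula : ∀ n c0 c1 cp .{{_ : NonZero n}} .{{_ : NonZero cp}} → c1 ≡ cp ℕ.* n ℕ.+ c0 →
                      ℕ→ℚ c1 /ℚ ℕ→ℚ cp ≡ ℕ→ℚ n ℚ.* (1ℚ ℚ.+ (ℕ→ℚ c0 /ℚ (ℕ→ℚ c1 ℚ.- ℕ→ℚ c0)))
expectation-formula n c0 c1 cp c1≡ = /ℚ-unique c1' p (n' ℚ.* (1ℚ ℚ.+ d)) (ℕ→ℚ-≢0 cp) (begin
  n' ℚ.* (1ℚ ℚ.+ d) ℚ.* p         ≡⟨ distribute p n' d ⟩
  p ℚ.* n' ℚ.+ d ℚ.* (p ℚ.* n')   ≡⟨ cong (λ g → p ℚ.* n' ℚ.+ d ℚ.* g) c1'-c0' ⟨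
  p ℚ.* n' ℚ.+ d ℚ.* (c1' ℚ.- c0') ≡⟨ cong (p ℚ.* n' ℚ.+_) d*gap ⟩
  p ℚ.* n' ℚ.+ c0'               ≡⟨ c1'≡ ⟨
  c1'                            ∎)
  where
  open ≡-Reasoning
  open +-*-Solver
  p = ℕ→ℚ cp
  n' = ℕ→ℚ n
  c0' = ℕ→ℚ c0
  c1' = ℕ→ℚ c1
  d = c0' /ℚ (c1' ℚ.- c0')
  c1'≡ : c1' ≡ p ℚ.* n' ℚ.+ c0'
  c1'≡ = trans (cong ℕ→ℚ c1≡) (trans (ℕ→ℚ-+ (cp ℕ.* n) c0) (cong (ℚ._+ c0') (ℕ→ℚ-* cp n)))
  c1'-c0' : c1' ℚ.- c0' ≡ p ℚ.* n'
  c1'-c0' = trans (cong (ℚ._- c0') c1'≡) (solve 2 (λ x a → x :+ a :- a := x) refl (p ℚ.* n') c0')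
  d*gap : d ℚ.* (c1' ℚ.- c0') ≡ c0'
  d*gap = /ℚ-*-cancel c0' (c1' ℚ.- c0')
            (subst (_≢ 0ℚ) (trans (ℕ→ℚ-* cp n) (sym c1'-c0')) (ℕ→ℚ-≢0 (cp ℕ.* n) {{ℕP.m*n≢0 cp n}}))
  distribute : ∀ p n d → n ℚ.* (1ℚ ℚ.+ d) ℚ.* p ≡ p ℚ.* n ℚ.+ d ℚ.* (p ℚ.* n)
  distribute = solve 3 (λ p n d → n :* (con 1ℚ :+ d) :* p := p :* n :+ d :* (p :* n)) refl

mainTheorem10 : (N : ℕ) (σ : ℤ → Bool)
    → (∀ k → T (σ k) → k ℤ.≤ + N)
    → T (σ (+ N))
    → (n : ℕ) → 1 ≤ n
    → (c0 c1 cp : ℕ)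
    → Enum (F σ 0 n) c0
    → Enum (F σ 1 n) c1
    → (e : Enum (P σ 1 n) cp)
    → (0 < cp) × (c0 < c1)
    × (expectedSteps e ≡ ℕ→ℚ n ℚ.* (1ℚ ℚ.+ (ℕ→ℚ c0 /ℚ (ℕ→ℚ c1 ℚ.- ℕ→ℚ c0))))
mainTheorem10 N σ _ S-N∈𝒮 n 1≤n c0 c1 cp E0 E1 e = 0<cp , c0<c1 , expectation
  where
  c1≡ : c1 ≡ cp ℕ.* n ℕ.+ c0
  c1≡ = trans (card-F₁≡Σlength σ n e E1)
              (trans (Σlength≡cp*n+Σ#V σ n e) (cong (cp ℕ.* n ℕ.+_) (sym (card-F₀≡Σ#V σ n e E0))))
  0<cp : 0 < cp
  0<cp = ℕ.>-nonZero⁻¹ cp {{FinP.nonZeroIndex (Inverse.from e (F⇒P σ n (V∷zigzags∈F σ N S-N∈𝒮 n)))}}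
  c0<c1 : c0 < c1
  c0<c1 = subst (c0 <_) (sym c1≡) (ℕP.m<n+m c0 (ℕP.*-mono-< 0<cp 1≤n))
  totalSteps≡c1 : totalSteps e ≡ c1
  totalSteps≡c1 = trans (totalSteps≡Σlength e) (sym (card-F₁≡Σlength σ n e E1))
  expectation : expectedSteps e ≡ ℕ→ℚ n ℚ.* (1ℚ ℚ.+ (ℕ→ℚ c0 /ℚ (ℕ→ℚ c1 ℚ.- ℕ→ℚ c0)))
  expectation = trans (cong (λ t → ℕ→ℚ t /ℚ ℕ→ℚ cp) totalSteps≡c1)
                      (expectation-formula n c0 c1 cp {{ℕ.>-nonZero 1≤n}} {{ℕ.>-nonZero 0<cp}} c1≡)
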